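{- Let $h \geq 2$ and let $c$ and $u$ be integers such that $c > 2h|u|$. Let $D_{c,u} = \{ -c,\,(h-1)c+u\}$. Then $D_{c,u}$ is a generalized Sidon set of order $h$, and $u \in hD_{c,u}$. Moreover, \[ \min\left\{|x-y| : x,y \in \bigcup_{r=1}^h rD_{c,u} \text{ and } x\neq y \right\} \geq c/2. \]
   Context: For a set $D$ of integers and a positive integer $r$, $rD = \{d_1+\cdots+d_r : d_i \in D\}$ denotes the $r$-fold sumset (summands not necessarily distinct). A set $A$ of integers is a generalized Sidon set of order $h$ if, for all pairs of positive integers $r, r'$ with $r \le h$ and $r' \le h$, and all sequences $a_1,\ldots,a_r$ and $a'_1,\ldots,a'_{r'}$ of elements of $A$, we have $a_1+\cdots+a_r = a'_1+\cdots+a'_{r'}$ if and only if $r=r'$ and $a'_i = a_{\sigma(i)}$ for some permutation $\sigma$ of $\{1,\ldots,r\}$ and all $i=1,\ldots,r$. -}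

module Defs where

open import Data.Nat as ℕ using (ℕ; suc)
open import Data.Integer using (ℤ; +_; -_; _+_; _*_; _-_; _<_; _≤_; ∣_∣)
open import Data.Fin using (Fin; zero; suc)
open import Data.Fin.Permutation using (Permutation; _⟨$⟩ʳ_)
open import Data.Product using (Σ; _×_; ∃)
open import Data.Sum using (_⊎_)
open import Relation.Binary.PropositionalEquality using (_≡_)
open import Function.Bundles using (_⇔_)

sumFin : ∀ {r} → (Fin r → ℤ) → ℤ
sumFin {ℕ.zero} a = + 0
sumFin {suc r} a = a zero + sumFin (λ i → a (suc i))

IntSet : Set₁
IntSet = ℤ → Set

SeqIn : IntSet → (r : ℕ) → (Fin r → ℤ) → Set
SeqIn A r a = ∀ i → A (a i)

_·_ : ℕ → IntSet → IntSet
(r · D) x = Σ (Fin r → ℤ) λ d → SeqIn D r d × sumFin d ≡ x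

UnionSumsets : ℕ → IntSet → IntSet
UnionSumsets h D x = Σ ℕ λ r → (1 ℕ.≤ r × r ℕ.≤ h) × (r · D) x

GenSidon : ℕ → IntSet → Set
GenSidon h A =
  ∀ (r r' : ℕ) → 1 ℕ.≤ r → r ℕ.≤ h → 1 ℕ.≤ r' → r' ℕ.≤ h →
  ∀ (a : Fin r → ℤ) (a' : Fin r' → ℤ) → SeqIn A r a → SeqIn A r' a' →
  (sumFin a ≡ sumFin a') ⇔
    (r ≡ r' × Σ (Permutation r' r) λ σ → ∀ i → a' i ≡ a (σ ⟨$⟩ʳ i))

D : ℕ → ℤ → ℤ → IntSet
D h c u x = x ≡ - c ⊎ x ≡ (+ (h ℕ.∸ 1)) * c + u

module Submission where

-- Write D = {p, q} with p = -c, q = (h-1)c + u.  A sequence of length r over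
-- {p, q} containing j copies of q is a rearrangement of the sorted sequence
-- q^j p^(r-j), and its sum is  j q + (r - j) p.  For two such sums,
--   (j q + (r-j) p) - (j' q + (r'-j') p) = ((j h + r') - (j' h + r)) c + (j - j') u,
-- and the "block index"  j h + r'  determines (j, r') when 1 ≤ r' ≤ h.  Hence
-- either both sums have the same (r, j) -- so the sequences are rearrangements
-- of one another -- or the first term is a nonzero multiple of c while the
-- second is at most h|u| < c/2 in size, so the sums are more than c/2 apart.

open import Defs
open import Data.Nat as ℕ using (ℕ)
open import Data.Integer using (ℤ; +_; _*_; _-_; _<_; _≤_; ∣_∣)
open import Data.Product using (_×_)
open import Relation.Binary.PropositionalEquality using (_≢_)

open import Data.Nat using (zero; suc; z≤n; s≤s)
import Data.Nat.Properties as ℕP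
import Data.Nat.Tactic.RingSolver as ℕSolver
open import Data.Integer using (_+_; -_; -[1+_]; +≤+; +<+)
import Data.Integer.Properties as ℤP
open import Data.Integer.Tactic.RingSolver using (solve-∀)
open import Data.Fin using (Fin; zero; suc)
open import Data.Fin.Permutation as Perm using (Permutation; _⟨$⟩ʳ_; _⟨$⟩ˡ_)
open import Data.Vec.Functional using (_∷_; tail)
open import Data.Product using (Σ; _,_)
open import Data.Sum as Sum using (_⊎_; inj₁; inj₂)
open import Relation.Binary.PropositionalEquality
  using (_≡_; refl; sym; trans; cong; cong₂; subst; module ≡-Reasoning)
open import Relation.Nullary using (yes; no)
open import Data.Empty using (⊥-elim)
open import Relation.Binary.Definitions using (tri<; tri≈; tri>)
open import Function.Bundles using (mk⇔)
import Algebra.Properties.CommutativeMonoid.Sum as MonoidSum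

private
  variable
    A : Set
    n : ℕ

-- `a ≈ₚ b`: the sequence  a  is a rearrangement of  b, i.e. a i = b (σ i) for
-- a permutation σ.  Its fields are the conclusion of `GenSidon` once r = r'.
record _≈ₚ_ (a b : Fin n → A) : Set where
  constructor _,_
  field
    perm       : Permutation n n
    rearranges : ∀ i → a i ≡ b (perm ⟨$⟩ʳ i)

infix 4 _≈ₚ_

≈ₚ-pointwise : {a b : Fin n → A} → (∀ i → a i ≡ b i) → a ≈ₚ b
≈ₚ-pointwise a≗b = Perm.id , a≗b

≈ₚ-trans : {a b c : Fin n → A} → a ≈ₚ b → b ≈ₚ c → a ≈ₚ c
≈ₚ-trans (σ , a≈b) (τ , b≈c) = σ Perm.∘ₚ τ , λ i → trans (a≈b i) (b≈c (σ ⟨$⟩ʳ i))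

≈ₚ-sym : {a b : Fin n → A} → a ≈ₚ b → b ≈ₚ a
≈ₚ-sym {b = b} (σ , a≈b) =
  Perm.flip σ , λ i → trans (cong b (sym (Perm.inverseʳ σ))) (sym (a≈b (σ ⟨$⟩ˡ i)))

≈ₚ-cons : {a : Fin (suc n) → A} {x : A} {b : Fin n → A} →
          a zero ≡ x → tail a ≈ₚ b → a ≈ₚ x ∷ b
≈ₚ-cons a₀≡x (τ , tail≈b) = Perm.lift₀ τ , λ { zero → a₀≡x ; (suc i) → tail≈b i }

≈ₚ-swap : {x y : A} {a : Fin n → A} → x ∷ y ∷ a ≈ₚ y ∷ x ∷ a
≈ₚ-swap = Perm.transpose zero (suc zero) ,
  λ { zero → refl ; (suc zero) → refl ; (suc (suc i)) → refl }

module SumFin = MonoidSum ℤP.+-0-commutativeMonoid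

sumFin≡sum : (a : Fin n → ℤ) → sumFin a ≡ SumFin.sum a
sumFin≡sum {zero} a = refl
sumFin≡sum {suc n} a = cong (λ s → a zero + s) (sumFin≡sum (tail a))

≈ₚ⇒sumFin≡ : {a b : Fin n → ℤ} → a ≈ₚ b → sumFin a ≡ sumFin b
≈ₚ⇒sumFin≡ {a = a} {b} (σ , a≈b) = begin
  sumFin a                          ≡⟨ sumFin≡sum a ⟩
  SumFin.sum a                      ≡⟨ SumFin.sum-cong-≗ a≈b ⟩
  SumFin.sum (λ i → b (σ ⟨$⟩ʳ i))   ≡⟨ SumFin.sum-permute b σ ⟨
  SumFin.sum b                      ≡⟨ sumFin≡sum b ⟨
  sumFin b                          ∎
  where open ≡-Reasoning

module TwoLetters (p q : A) where

  OverPQ : (Fin n → A) → Set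
  OverPQ {n} a = ∀ i → a i ≡ p ⊎ a i ≡ q

  tailPQ : {a : Fin (suc n) → A} → OverPQ a → OverPQ (tail a)
  tailPQ m i = m (suc i)

  -- the number of entries that are (recorded as)  q
  countQ : (a : Fin n → A) → OverPQ a → ℕ
  countQ {zero} a m = 0
  countQ {suc n} a m with m zero
  ... | inj₁ _ = countQ (tail a) (tailPQ m)
  ... | inj₂ _ = suc (countQ (tail a) (tailPQ m))

  countQ≤length : (a : Fin n → A) (m : OverPQ a) → countQ a m ℕ.≤ n
  countQ≤length {zero} a m = z≤n
  countQ≤length {suc n} a m with m zero
  ... | inj₁ _ = ℕP.m≤n⇒m≤1+n (countQ≤length (tail a) (tailPQ m))
  ... | inj₂ _ = s≤s (countQ≤length (tail a) (tailPQ m))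

  sorted : (n j : ℕ) → Fin n → A
  sorted zero    j       ()
  sorted (suc n) zero    = p ∷ sorted n zero
  sorted (suc n) (suc j) = q ∷ sorted n j

  p∷sorted≈ₚsorted : ∀ n j → j ℕ.≤ n → p ∷ sorted n j ≈ₚ sorted (suc n) j
  p∷sorted≈ₚsorted n       zero    _         = ≈ₚ-pointwise λ _ → refl
  p∷sorted≈ₚsorted (suc n) (suc j) (s≤s j≤n) =
    ≈ₚ-trans ≈ₚ-swap (≈ₚ-cons refl (p∷sorted≈ₚsorted n j j≤n))

  ≈ₚsorted : (a : Fin n → A) (m : OverPQ a) → a ≈ₚ sorted n (countQ a m)
  ≈ₚsorted {zero}  a m = ≈ₚ-pointwise λ ()
  ≈ₚsorted {suc n} a m with m zero
  ... | inj₁ a₀≡p = ≈ₚ-trans (≈ₚ-cons a₀≡p (≈ₚsorted (tail a) (tailPQ m)))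
                             (p∷sorted≈ₚsorted n _ (countQ≤length (tail a) (tailPQ m)))
  ... | inj₂ a₀≡q = ≈ₚ-cons a₀≡q (≈ₚsorted (tail a) (tailPQ m))

  sameCount⇒≈ₚ : (a b : Fin n → A) (m : OverPQ a) (m' : OverPQ b) →
                 countQ a m ≡ countQ b m' → a ≈ₚ b
  sameCount⇒≈ₚ {n} a b m m' same =
    ≈ₚ-trans (subst (λ j → a ≈ₚ sorted n j) same (≈ₚsorted a m)) (≈ₚ-sym (≈ₚsorted b m'))

module TwoLetterSums (p q : ℤ) where
  open TwoLetters p q

  pqSum : ℕ → ℕ → ℤ
  pqSum r j = + j * q + (+ r - + j) * p

  sumFin≡pqSum : (a : Fin n → ℤ) (m : OverPQ a) → sumFin a ≡ pqSum n (countQ a m)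
  sumFin≡pqSum {zero}  a m = refl
  sumFin≡pqSum {suc n} a m with m zero
  ... | inj₁ a₀≡p = trans (cong₂ _+_ a₀≡p (sumFin≡pqSum (tail a) (tailPQ m)))
                          (prepend-p p q (+ n) (+ countQ (tail a) (tailPQ m)))
    where
    prepend-p : ∀ x y R J → x + (J * y + (R - J) * x) ≡ J * y + ((+ 1 + R) - J) * x
    prepend-p = solve-∀
  ... | inj₂ a₀≡q = trans (cong₂ _+_ a₀≡q (sumFin≡pqSum (tail a) (tailPQ m)))
                          (prepend-q p q (+ n) (+ countQ (tail a) (tailPQ m)))
    where
    prepend-q : ∀ x y R J → y + (J * y + (R - J) * x) ≡ (+ 1 + J) * y + ((+ 1 + R) - (+ 1 + J)) * x
    prepend-q = solve-∀

block-< : ∀ h {j j' r r'} → j ℕ.< j' → r' ℕ.≤ h → 1 ℕ.≤ r → j ℕ.* h ℕ.+ r' ℕ.< j' ℕ.* h ℕ.+ r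
block-< h {j} {j'} {r} {r'} j<j' r'≤h 1≤r = begin-strict
  j ℕ.* h ℕ.+ r'  ≤⟨ ℕP.+-monoʳ-≤ (j ℕ.* h) r'≤h ⟩
  j ℕ.* h ℕ.+ h   ≡⟨ ℕP.+-comm (j ℕ.* h) h ⟩
  suc j ℕ.* h     ≤⟨ ℕP.*-monoˡ-≤ h j<j' ⟩
  j' ℕ.* h        <⟨ ℕP.m<m+n (j' ℕ.* h) 1≤r ⟩
  j' ℕ.* h ℕ.+ r  ∎
  where open ℕP.≤-Reasoning

block-injective : ∀ h {j j' r r'} → 1 ℕ.≤ r → r ℕ.≤ h → 1 ℕ.≤ r' → r' ℕ.≤ h →
                  j ℕ.* h ℕ.+ r' ≡ j' ℕ.* h ℕ.+ r → j ≡ j' × r' ≡ r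
block-injective h {j} {j'} 1≤r r≤h 1≤r' r'≤h eq with ℕP.<-cmp j j'
... | tri< j<j' _ _ = ⊥-elim (ℕP.<-irrefl eq (block-< h j<j' r'≤h 1≤r))
... | tri> _ _ j>j' = ⊥-elim (ℕP.<-irrefl (sym eq) (block-< h j>j' r≤h 1≤r'))
... | tri≈ _ refl _ = refl , ℕP.+-cancelˡ-≡ (j ℕ.* h) _ _ eq

halve : ∀ {c d x} → c ℕ.≤ d ℕ.+ x → 2 ℕ.* x ℕ.< c → c ℕ.< 2 ℕ.* d
halve {c} {d} {x} c≤d+x 2x<c = ℕP.+-cancelʳ-< c c (2 ℕ.* d) (begin-strict
  c ℕ.+ c                        ≤⟨ ℕP.+-mono-≤ c≤d+x c≤d+x ⟩
  (d ℕ.+ x) ℕ.+ (d ℕ.+ x)        ≡⟨ regroup d x ⟩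
  2 ℕ.* d ℕ.+ 2 ℕ.* x            <⟨ ℕP.+-monoʳ-< (2 ℕ.* d) 2x<c ⟩
  2 ℕ.* d ℕ.+ c                  ∎)
  where
  open ℕP.≤-Reasoning
  regroup : ∀ d x → (d ℕ.+ x) ℕ.+ (d ℕ.+ x) ≡ 2 ℕ.* d ℕ.+ 2 ℕ.* x
  regroup = ℕSolver.solve-∀

nonzero⇒1≤∣∣ : ∀ {k} → k ≢ + 0 → 1 ℕ.≤ ∣ k ∣
nonzero⇒1≤∣∣ {+ zero}  k≢0 = ⊥-elim (k≢0 refl)
nonzero⇒1≤∣∣ {+ suc _} _   = s≤s z≤n
nonzero⇒1≤∣∣ { -[1+ _ ] } _ = s≤s z≤n

separation : ∀ h (k e : ℤ) (c : ℕ) (u : ℤ) → k ≢ + 0 → ∣ e ∣ ℕ.≤ h →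
             2 ℕ.* (h ℕ.* ∣ u ∣) ℕ.< c → c ℕ.< 2 ℕ.* ∣ k * + c + e * u ∣
separation h k e c u k≢0 ∣e∣≤h 2h∣u∣<c = halve {d = ∣ k * + c + e * u ∣} (begin
  c                                 ≡⟨ ℕP.*-identityˡ c ⟨
  1 ℕ.* c                           ≤⟨ ℕP.*-monoˡ-≤ c (nonzero⇒1≤∣∣ k≢0) ⟩
  ∣ k ∣ ℕ.* c                       ≡⟨ ℤP.∣i*j∣≡∣i∣*∣j∣ k (+ c) ⟨
  ∣ k * + c ∣                       ≡⟨ cong ∣_∣ (cancel (k * + c) (e * u)) ⟨
  ∣ (k * + c + e * u) - e * u ∣     ≤⟨ ℤP.∣i-j∣≤∣i∣+∣j∣ (k * + c + e * u) (e * u) ⟩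
  ∣ k * + c + e * u ∣ ℕ.+ ∣ e * u ∣ ≤⟨ ℕP.+-monoʳ-≤ ∣ k * + c + e * u ∣ ∣eu∣≤h∣u∣ ⟩
  ∣ k * + c + e * u ∣ ℕ.+ h ℕ.* ∣ u ∣ ∎) 2h∣u∣<c
  where
  open ℕP.≤-Reasoning
  cancel : ∀ a b → (a + b) - b ≡ a
  cancel = solve-∀
  ∣eu∣≤h∣u∣ : ∣ e * u ∣ ℕ.≤ h ℕ.* ∣ u ∣
  ∣eu∣≤h∣u∣ = subst (ℕ._≤ h ℕ.* ∣ u ∣) (sym (ℤP.∣i*j∣≡∣i∣*∣j∣ e u)) (ℕP.*-monoˡ-≤ ∣ u ∣ ∣e∣≤h)

∣m-n∣≤bound : ∀ {m n h} → m ℕ.≤ h → n ℕ.≤ h → ∣ + m - + n ∣ ℕ.≤ h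
∣m-n∣≤bound {m} {n} m≤h n≤h =
  subst (ℕ._≤ _) (cong ∣_∣ (sym (ℤP.m-n≡m⊖n m n)))
        (ℕP.≤-trans (ℤP.∣m⊝n∣≤m⊔n m n) (ℕP.⊔-lub m≤h n≤h))

sumFin-const : ∀ n (x : ℤ) → sumFin {n} (λ _ → x) ≡ + n * x
sumFin-const zero    x = refl
sumFin-const (suc n) x = trans (cong (λ s → x + s) (sumFin-const n x)) (one-more (+ n) x)
  where
  one-more : ∀ N x → x + N * x ≡ (+ 1 + N) * x
  one-more = solve-∀

module SidonD (H c : ℕ) (u : ℤ) (2h∣u∣<c : 2 ℕ.* (suc H ℕ.* ∣ u ∣) ℕ.< c) where

  h : ℕ
  h = suc H

  p q : ℤ
  p = - + c
  q = + H * + c + u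

  open TwoLetters p q
  open TwoLetterSums p q

  -- The block index  j h + r'  turns the difference of two sums into
  -- "multiple of c  +  small multiple of u".
  pqSum-difference : ∀ r j r' j' → pqSum r j - pqSum r' j'
                     ≡ (+ (j ℕ.* h ℕ.+ r') - + (j' ℕ.* h ℕ.+ r)) * + c + (+ j - + j') * u
  pqSum-difference r j r' j' = begin
    pqSum r j - pqSum r' j'
      ≡⟨ expand (+ H) (+ c) u (+ j) (+ r) (+ j') (+ r') ⟩
    ((+ j * + h + + r') - (+ j' * + h + + r)) * + c + (+ j - + j') * u
      ≡⟨ cong (λ k → k * + c + (+ j - + j') * u) (cong₂ _-_ (blockℤ j r') (blockℤ j' r)) ⟩
    (+ (j ℕ.* h ℕ.+ r') - + (j' ℕ.* h ℕ.+ r)) * + c + (+ j - + j') * u ∎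
    where
    open ≡-Reasoning
    expand : ∀ H c u J R J' R' →
      (J * (H * c + u) + (R - J) * (- c)) - (J' * (H * c + u) + (R' - J') * (- c))
      ≡ ((J * (+ 1 + H) + R') - (J' * (+ 1 + H) + R)) * c + (J - J') * u
    expand = solve-∀
    blockℤ : ∀ j r → + j * + h + + r ≡ + (j ℕ.* h ℕ.+ r)
    blockℤ j r = trans (cong (λ s → s + + r) (sym (ℤP.pos-* j h))) (sym (ℤP.pos-+ (j ℕ.* h) r))

  same-shape-or-far : ∀ {r r' j j'} → 1 ℕ.≤ r → r ℕ.≤ h → 1 ℕ.≤ r' → r' ℕ.≤ h →
    j ℕ.≤ r → j' ℕ.≤ r' →
    (r ≡ r' × j ≡ j') ⊎ c ℕ.< 2 ℕ.* ∣ pqSum r j - pqSum r' j' ∣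
  same-shape-or-far {r} {r'} {j} {j'} 1≤r r≤h 1≤r' r'≤h j≤r j'≤r'
    with j ℕ.* h ℕ.+ r' ℕ.≟ j' ℕ.* h ℕ.+ r
  ... | yes same-block with block-injective h 1≤r r≤h 1≤r' r'≤h same-block
  ...   | j≡j' , r'≡r = inj₁ (sym r'≡r , j≡j')
  same-shape-or-far {r} {r'} {j} {j'} 1≤r r≤h 1≤r' r'≤h j≤r j'≤r' | no other-block =
    inj₂ (subst (λ d → c ℕ.< 2 ℕ.* ∣ d ∣) (sym (pqSum-difference r j r' j'))
                (separation h k (+ j - + j') c u k≢0 (∣m-n∣≤bound j≤h j'≤h) 2h∣u∣<c))
    where
    k = + (j ℕ.* h ℕ.+ r') - + (j' ℕ.* h ℕ.+ r)
    k≢0 : k ≢ + 0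
    k≢0 k≡0 = other-block (ℤP.+-injective (ℤP.i-j≡0⇒i≡j _ _ k≡0))
    j≤h : j ℕ.≤ h
    j≤h = ℕP.≤-trans j≤r r≤h
    j'≤h : j' ℕ.≤ h
    j'≤h = ℕP.≤-trans j'≤r' r'≤h

  same-count-or-far : ∀ {r r'} → 1 ℕ.≤ r → r ℕ.≤ h → 1 ℕ.≤ r' → r' ℕ.≤ h →
    (a : Fin r → ℤ) (a' : Fin r' → ℤ) (m : OverPQ a) (m' : OverPQ a') →
    (r ≡ r' × countQ a m ≡ countQ a' m') ⊎ c ℕ.< 2 ℕ.* ∣ sumFin a - sumFin a' ∣
  same-count-or-far 1≤r r≤h 1≤r' r'≤h a a' m m' =
    Sum.map₂ (subst (λ d → c ℕ.< 2 ℕ.* ∣ d ∣) (sym (cong₂ _-_ (sumFin≡pqSum a m) (sumFin≡pqSum a' m'))))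
             (same-shape-or-far 1≤r r≤h 1≤r' r'≤h (countQ≤length a m) (countQ≤length a' m'))

  isGenSidon : GenSidon h (D h (+ c) u)
  isGenSidon r r' 1≤r r≤h 1≤r' r'≤h a a' m m' = mk⇔ equal-sums⇒rearranged rearranged⇒equal-sums
    where
    equal-sums⇒rearranged : sumFin a ≡ sumFin a' →
      r ≡ r' × Σ (Permutation r' r) λ σ → ∀ i → a' i ≡ a (σ ⟨$⟩ʳ i)
    equal-sums⇒rearranged equal with same-count-or-far 1≤r r≤h 1≤r' r'≤h a a' m m'
    ... | inj₁ (refl , same) = refl , perm , rearranges
      where open _≈ₚ_ (sameCount⇒≈ₚ a' a m' m (sym same))
    ... | inj₂ far = ⊥-elim (ℕP.n≮0 (subst (λ d → c ℕ.< 2 ℕ.* ∣ d ∣) (ℤP.i≡j⇒i-j≡0 equal) far))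
    rearranged⇒equal-sums : (r ≡ r' × Σ (Permutation r' r) λ σ → ∀ i → a' i ≡ a (σ ⟨$⟩ʳ i)) →
      sumFin a ≡ sumFin a'
    rearranged⇒equal-sums (refl , σ , a'≈a) = sym (≈ₚ⇒sumFin≡ (σ , a'≈a))

  -- u = q + H p  is a sum of  h  elements of D.
  u∈hD : (h · D h (+ c) u) u
  u∈hD = q ∷ (λ _ → p) , (λ { zero → inj₂ refl ; (suc _) → inj₁ refl }) , (begin
    q + sumFin {H} (λ _ → p) ≡⟨ cong (λ s → q + s) (sumFin-const H p) ⟩
    q + + H * p              ≡⟨ cancel (+ H) (+ c) u ⟩
    u                        ∎)
    where
    open ≡-Reasoning
    cancel : ∀ H c u → (H * c + u) + H * (- c) ≡ u
    cancel = solve-∀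

  separated : ∀ x y → UnionSumsets h (D h (+ c) u) x → UnionSumsets h (D h (+ c) u) y →
              x ≢ y → + c ≤ + 2 * + ∣ x - y ∣
  separated x y (r , (1≤r , r≤h) , a , m , refl) (r' , (1≤r' , r'≤h) , a' , m' , refl) x≢y
    with same-count-or-far 1≤r r≤h 1≤r' r'≤h a a' m m'
  ... | inj₁ (refl , same) = ⊥-elim (x≢y (begin
    sumFin a                 ≡⟨ sumFin≡pqSum a m ⟩
    pqSum r (countQ a m)     ≡⟨ cong (pqSum r) same ⟩
    pqSum r (countQ a' m')   ≡⟨ sumFin≡pqSum a' m' ⟨
    sumFin a'                ∎))
    where open ≡-Reasoning
  ... | inj₂ far = subst (+ c ≤_) (ℤP.pos-* 2 ∣ x - y ∣) (+≤+ (ℕP.<⇒≤ far))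

-- The theorem holds for every  h ≥ 1; the hypothesis  h ≥ 2  only excludes  h = 0,
-- and  c > 2h|u| ≥ 0  excludes negative  c.
mainTheorem1 : (h : ℕ) → 2 ℕ.≤ h → (c u : ℤ) → + (2 ℕ.* h ℕ.* ∣ u ∣) < c →
    GenSidon h (D h c u)
    × (h · D h c u) u
    × (∀ x y → UnionSumsets h (D h c u) x → UnionSumsets h (D h c u) y → x ≢ y →
         c ≤ + 2 * (+ ∣ x - y ∣))
mainTheorem1 zero    () _ _ _
mainTheorem1 (suc H) _ (+ c) u (+<+ 2h∣u∣<c) = isGenSidon , u∈hD , separated
  where open SidonD H c u (subst (ℕ._< c) (ℕP.*-assoc 2 (suc H) ∣ u ∣) 2h∣u∣<c)
mainTheorem1 _ _ -[1+ _ ] _ ()
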